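{- For every positive integer $n$, there exists a set $\mathcal{P} \subseteq \left(\tfrac{1}{2}\mathbb{Z}\right)^n$ with $|\mathcal{P}| = 2^n$ such that for all distinct $\mathbf{p}, \mathbf{q} \in \mathcal{P}$, the $\ell_1$-distance $\|\mathbf{p}-\mathbf{q}\|_1 = \sum_{i=1}^n |p_i - q_i|$ is an odd integer. In particular, $\mathrm{odd}_1(n) \geq 2^n$.
   Context: $\tfrac{1}{2}\mathbb{Z} = \{k/2 : k \in \mathbb{Z}\}$ denotes the set of half-integers (including integers). An $\ell_1$-odd-distance set in $\mathbb{R}^n$ is a set of points such that all pairwise $\ell_1$-distances (for distinct points) are odd integers. $\mathrm{odd}_1(n)$ denotes the maximum size of an $\ell_1$-odd-distance set in $\mathbb{R}^n$. -}

module Defs where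

open import Data.Nat using (ℕ; zero; suc)
open import Data.Fin using (Fin; zero; suc)
open import Data.Integer using (ℤ; +_)
open import Data.Rational using (ℚ; 0ℚ; _+_; _-_; _*_; ∣_∣; _/_)
open import Data.Product using (∃)
open import Relation.Binary.PropositionalEquality using (_≡_)

sumℚ : (n : ℕ) → (Fin n → ℚ) → ℚ
sumℚ zero    f = 0ℚ
sumℚ (suc n) f = f zero + sumℚ n (λ i → f (suc i))

Point : ℕ → Set
Point n = Fin n → ℚ

IsHalfInteger : ℚ → Set
IsHalfInteger x = ∃ λ (k : ℤ) → x ≡ k / 2

InHalfIntLattice : (n : ℕ) → Point n → Set
InHalfIntLattice n p = (i : Fin n) → IsHalfInteger (p i)

dist₁ : (n : ℕ) → Point n → Point n → ℚ
dist₁ n p q = sumℚ n (λ i → ∣ p i - q i ∣)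

IsOddInteger : ℚ → Set
IsOddInteger x = ∃ λ (k : ℤ) → x ≡ (ℤ-odd k) / 1
  where
  open import Data.Integer using () renaming (_+_ to _+ℤ_; _*_ to _*ℤ_)
  ℤ-odd : ℤ → ℤ
  ℤ-odd k = (+ 2) *ℤ k +ℤ (+ 1)

-- Work in half units: a vector xs of naturals stands for the point xs / 2.
-- Starting from the two points 0 and 1 on the line, each point with first
-- coordinate x and remaining coordinates r is replaced by the two points
-- (2x, x + ½, 3r) and (2x + ½, x, 3r).  If two old points have different
-- first coordinates, the two new leading coordinates move in the same
-- direction and together contribute 3|x - x'|, so every distance is
-- multiplied by 3; the two children of one point are at distance 1.  An odd
-- distance times 3 is odd, and the new first coordinates are again pairwise
-- distinct, so the construction iterates.
module Submission where

open import Defs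
open import Data.Nat using (ℕ; _^_; NonZero)
open import Data.Fin using (Fin)
open import Data.Product using (Σ; _×_)
open import Function.Definitions using (Injective)
open import Relation.Binary.PropositionalEquality using (_≡_)
open import Relation.Nullary using (¬_)

open import Data.Nat using (suc; _+_; _*_; _<_; ∣_-_∣; _≟_)
import Data.Nat.Properties as ℕₚ
open import Data.Nat.Tactic.RingSolver using (solve-∀)
open import Data.Integer as ℤ using (ℤ; _⊖_)
import Data.Integer.Properties as ℤₚ
import Data.Integer.Tactic.RingSolver as ℤ-Solver
open import Data.Rational as ℚ using (ℚ; fromℚᵘ; _/_)
import Data.Rational.Properties as ℚₚ
open import Data.Rational.Unnormalised as ℚᵘ using (mkℚᵘ; *≡*)
import Data.Rational.Unnormalised.Properties as ℚᵘₚ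
open import Data.Fin using (zero; suc; toℕ; remQuot)
open import Data.Fin.Properties using (*↔×)
open import Data.Vec using (Vec; []; _∷_; head; tail; _++_; map; zipWith; lookup)
open import Data.Product using (_,_; ∃)
open import Data.Sum using (inj₁; inj₂)
open import Function using (_∘_)
open import Function.Bundles using (Injection)
open import Function.Properties.Inverse using (↔⇒↣)
open import Relation.Binary.Definitions using (tri<; tri≈; tri>)
open import Relation.Binary.PropositionalEquality
  using (refl; sym; trans; cong; cong₂; subst; _≢_; module ≡-Reasoning)
open import Relation.Nullary using (yes; no; contradiction)

open ≡-Reasoning

dist : ∀ {n} → Vec ℕ n → Vec ℕ n → ℕ
dist []       []       = 0
dist (x ∷ xs) (y ∷ ys) = ∣ x - y ∣ + dist xs ys

dist-self : ∀ {n} (xs : Vec ℕ n) → dist xs xs ≡ 0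
dist-self []       = refl
dist-self (x ∷ xs) = cong₂ _+_ (ℕₚ.∣n-n∣≡0 x) (dist-self xs)

dist-comm : ∀ {n} (xs ys : Vec ℕ n) → dist xs ys ≡ dist ys xs
dist-comm []       []       = refl
dist-comm (x ∷ xs) (y ∷ ys) = cong₂ _+_ (ℕₚ.∣-∣-comm x y) (dist-comm xs ys)

dist-++ : ∀ {m n} (xs ys : Vec ℕ m) (us vs : Vec ℕ n) →
          dist (xs ++ us) (ys ++ vs) ≡ dist xs ys + dist us vs
dist-++ []       []       us vs = refl
dist-++ (x ∷ xs) (y ∷ ys) us vs = begin
  ∣ x - y ∣ + dist (xs ++ us) (ys ++ vs)   ≡⟨ cong (∣ x - y ∣ +_) (dist-++ xs ys us vs) ⟩
  ∣ x - y ∣ + (dist xs ys + dist us vs)    ≡⟨ ℕₚ.+-assoc ∣ x - y ∣ (dist xs ys) (dist us vs) ⟨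
  ∣ x - y ∣ + dist xs ys + dist us vs      ∎

dist-*ˡ : ∀ {n} c (xs ys : Vec ℕ n) → dist (map (c *_) xs) (map (c *_) ys) ≡ c * dist xs ys
dist-*ˡ c []       []       = sym (ℕₚ.*-zeroʳ c)
dist-*ˡ c (x ∷ xs) (y ∷ ys) = begin
  ∣ c * x - c * y ∣ + dist (map (c *_) xs) (map (c *_) ys)
    ≡⟨ cong₂ _+_ (sym (ℕₚ.*-distribˡ-∣-∣ c x y)) (dist-*ˡ c xs ys) ⟩
  c * ∣ x - y ∣ + c * dist xs ys
    ≡⟨ ℕₚ.*-distribˡ-+ c ∣ x - y ∣ (dist xs ys) ⟨
  c * (∣ x - y ∣ + dist xs ys)
    ∎

dist-translate : ∀ {n} (s xs ys : Vec ℕ n) →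
                 dist (zipWith _+_ s xs) (zipWith _+_ s ys) ≡ dist xs ys
dist-translate []      []       []       = refl
dist-translate (c ∷ s) (x ∷ xs) (y ∷ ys) =
  cong₂ _+_ (ℕₚ.∣m+n-m+o∣≡∣n-o∣ c x y) (dist-translate s xs ys)

lead : Fin 2 → ℕ → Vec ℕ 2
lead zero       m = 2 * m     ∷ 1 + m ∷ []
lead (suc zero) m = 1 + 2 * m ∷ m     ∷ []

head-lead-injective : ∀ b b' m m' → head (lead b m) ≡ head (lead b' m') → b ≡ b' × m ≡ m'
head-lead-injective zero       zero       m m' e = refl , ℕₚ.*-cancelˡ-≡ m m' 2 e
head-lead-injective zero       (suc zero) m m' e = contradiction e (ℕₚ.even≢odd m m')
head-lead-injective (suc zero) zero       m m' e = contradiction (sym e) (ℕₚ.even≢odd m' m)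
head-lead-injective (suc zero) (suc zero) m m' e = refl , ℕₚ.*-cancelˡ-≡ m m' 2 (ℕₚ.suc-injective e)

lead-+ : ∀ b c m → lead b (c + m) ≡ zipWith _+_ (2 * c ∷ c ∷ []) (lead b m)
lead-+ zero       c m = cong₂ (λ x y → x ∷ y ∷ []) (ℕₚ.*-distribˡ-+ 2 c m) (sym (ℕₚ.+-suc c m))
lead-+ (suc zero) c m = cong (λ x → x ∷ c + m ∷ [])
  (trans (cong suc (ℕₚ.*-distribˡ-+ 2 c m)) (sym (ℕₚ.+-suc (2 * c) (2 * m))))

dist-lead-shift : ∀ b b' m d → dist (lead b m) (lead b' (m + d)) ≡ dist (lead b 0) (lead b' d)
dist-lead-shift b b' m d = begin
  dist (lead b m) (lead b' (m + d))
    ≡⟨ cong (λ x → dist (lead b x) (lead b' (m + d))) (ℕₚ.+-identityʳ m) ⟨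
  dist (lead b (m + 0)) (lead b' (m + d))
    ≡⟨ cong₂ dist (lead-+ b m 0) (lead-+ b' m d) ⟩
  dist (zipWith _+_ (2 * m ∷ m ∷ []) (lead b 0)) (zipWith _+_ (2 * m ∷ m ∷ []) (lead b' d))
    ≡⟨ dist-translate (2 * m ∷ m ∷ []) (lead b 0) (lead b' d) ⟩
  dist (lead b 0) (lead b' d)
    ∎

dist-lead-0-0 : ∀ b b' → b ≢ b' → dist (lead b 0) (lead b' 0) ≡ 2
dist-lead-0-0 zero       zero       b≢b' = contradiction refl b≢b'
dist-lead-0-0 zero       (suc zero) b≢b' = refl
dist-lead-0-0 (suc zero) zero       b≢b' = refl
dist-lead-0-0 (suc zero) (suc zero) b≢b' = contradiction refl b≢b'

-- Each left-hand side is the normal form of the sum of the two coordinate gaps.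
dist-lead-0-suc : ∀ b b' d → dist (lead b 0) (lead b' (suc d)) ≡ 3 * suc d
dist-lead-0-suc zero       zero       = gaps
  where gaps : ∀ d → 2 * (1 + d) + ((1 + d) + 0) ≡ 3 * (1 + d)
        gaps = solve-∀
dist-lead-0-suc zero       (suc zero) = gaps
  where gaps : ∀ d → (1 + 2 * (1 + d)) + (d + 0) ≡ 3 * (1 + d)
        gaps = solve-∀
dist-lead-0-suc (suc zero) zero       = gaps
  where gaps : ∀ d → (d + (1 + d + 0)) + (2 + d + 0) ≡ 3 * (1 + d)
        gaps = solve-∀
dist-lead-0-suc (suc zero) (suc zero) = gaps
  where gaps : ∀ d → 2 * (1 + d) + ((1 + d) + 0) ≡ 3 * (1 + d)
        gaps = solve-∀

dist-lead-same : ∀ b b' m → b ≢ b' → dist (lead b m) (lead b' m) ≡ 2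
dist-lead-same b b' m b≢b' = begin
  dist (lead b m) (lead b' m)        ≡⟨ cong (λ x → dist (lead b m) (lead b' x)) (ℕₚ.+-identityʳ m) ⟨
  dist (lead b m) (lead b' (m + 0))  ≡⟨ dist-lead-shift b b' m 0 ⟩
  dist (lead b 0) (lead b' 0)        ≡⟨ dist-lead-0-0 b b' b≢b' ⟩
  2                                  ∎

dist-lead-< : ∀ b b' {m m'} → m < m' → dist (lead b m) (lead b' m') ≡ 3 * ∣ m - m' ∣
dist-lead-< b b' {m} m<m' with d , refl ← ℕₚ.m≤n⇒∃[o]m+o≡n m<m' = begin
  dist (lead b m) (lead b' (suc (m + d)))  ≡⟨ cong (λ x → dist (lead b m) (lead b' x)) (ℕₚ.+-suc m d) ⟨
  dist (lead b m) (lead b' (m + suc d))    ≡⟨ dist-lead-shift b b' m (suc d) ⟩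
  dist (lead b 0) (lead b' (suc d))        ≡⟨ dist-lead-0-suc b b' d ⟩
  3 * suc d                                ≡⟨ cong (3 *_) (ℕₚ.∣m-m+n∣≡n m (suc d)) ⟨
  3 * ∣ m - m + suc d ∣                    ≡⟨ cong (λ x → 3 * ∣ m - x ∣) (ℕₚ.+-suc m d) ⟩
  3 * ∣ m - suc (m + d) ∣                  ∎

dist-lead-≢ : ∀ b b' {m m'} → m ≢ m' → dist (lead b m) (lead b' m') ≡ 3 * ∣ m - m' ∣
dist-lead-≢ b b' {m} {m'} m≢m' with ℕₚ.<-cmp m m'
... | tri< m<m' _ _ = dist-lead-< b b' m<m'
... | tri≈ _ m≡m' _ = contradiction m≡m' m≢m'
... | tri> _ _ m'<m = begin
  dist (lead b m) (lead b' m')  ≡⟨ dist-comm (lead b m) (lead b' m') ⟩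
  dist (lead b' m') (lead b m)  ≡⟨ dist-lead-< b' b m'<m ⟩
  3 * ∣ m' - m ∣                ≡⟨ cong (3 *_) (ℕₚ.∣-∣-comm m' m) ⟩
  3 * ∣ m - m' ∣                ∎

lift : ∀ {n} → Fin 2 → Vec ℕ (suc n) → Vec ℕ (suc (suc n))
lift b (m ∷ xs) = lead b m ++ map (3 *_) xs

head-lift : ∀ {n} b (xs : Vec ℕ (suc n)) → head (lift b xs) ≡ head (lead b (head xs))
head-lift zero       (m ∷ xs) = refl
head-lift (suc zero) (m ∷ xs) = refl

dist-lift : ∀ {n} b b' (xs ys : Vec ℕ (suc n)) →
            dist (lift b xs) (lift b' ys)
              ≡ dist (lead b (head xs)) (lead b' (head ys)) + 3 * dist (tail xs) (tail ys)
dist-lift b b' (x ∷ xs) (y ∷ ys) =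
  trans (dist-++ (lead b x) (lead b' y) _ _) (cong (dist (lead b x) (lead b' y) +_) (dist-*ˡ 3 xs ys))

dist-lift-≢ : ∀ {n} b b' (xs ys : Vec ℕ (suc n)) → head xs ≢ head ys →
              dist (lift b xs) (lift b' ys) ≡ 3 * dist xs ys
dist-lift-≢ b b' xs@(x ∷ xs') ys@(y ∷ ys') x≢y = begin
  dist (lift b xs) (lift b' ys)                       ≡⟨ dist-lift b b' xs ys ⟩
  dist (lead b x) (lead b' y) + 3 * dist xs' ys'      ≡⟨ cong (_+ 3 * dist xs' ys') (dist-lead-≢ b b' x≢y) ⟩
  3 * ∣ x - y ∣ + 3 * dist xs' ys'                    ≡⟨ ℕₚ.*-distribˡ-+ 3 ∣ x - y ∣ (dist xs' ys') ⟨
  3 * dist xs ys                                      ∎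

dist-lift-same : ∀ {n} b b' (xs : Vec ℕ (suc n)) → b ≢ b' → dist (lift b xs) (lift b' xs) ≡ 2
dist-lift-same b b' xs b≢b' = trans (dist-lift b b' xs xs)
  (cong₂ _+_ (dist-lead-same b b' (head xs) b≢b') (cong (3 *_) (dist-self (tail xs))))

TwiceOdd : ℕ → Set
TwiceOdd d = ∃ λ k → d ≡ 2 + 4 * k

TwiceOdd-3* : ∀ {d} → TwiceOdd d → TwiceOdd (3 * d)
TwiceOdd-3* (k , refl) = 1 + 3 * k , triple k
  where triple : ∀ k → 3 * (2 + 4 * k) ≡ 2 + 4 * (1 + 3 * k)
        triple = solve-∀

record OddConfiguration {I : Set} {n} (P : I → Vec ℕ (suc n)) : Set where
  field
    head-injective : Injective _≡_ _≡_ (head ∘ P)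
    twiceOdd       : ∀ {i j} → i ≢ j → TwiceOdd (dist (P i) (P j))

OddConfiguration-∘ : ∀ {I J : Set} {n} {P : I → Vec ℕ (suc n)} {f : J → I} →
                     OddConfiguration P → Injective _≡_ _≡_ f → OddConfiguration (P ∘ f)
OddConfiguration-∘ odd f-injective = record
  { head-injective = f-injective ∘ head-injective
  ; twiceOdd       = λ i≢j → twiceOdd (i≢j ∘ f-injective)
  }
  where open OddConfiguration odd

doubling : ∀ {I : Set} {n} → (I → Vec ℕ (suc n)) → Fin 2 × I → Vec ℕ (suc (suc n))
doubling P (b , i) = lift b (P i)

doubling-odd : ∀ {I : Set} {n} {P : I → Vec ℕ (suc n)} →
               OddConfiguration P → OddConfiguration (doubling P)
doubling-odd {P = P} odd = record { head-injective = injective ; twiceOdd = twice-odd }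
  where
  open OddConfiguration odd
  injective : Injective _≡_ _≡_ (head ∘ doubling P)
  injective {b , i} {b' , j} e
    with refl , heads≡ ← head-lead-injective b b' (head (P i)) (head (P j))
                           (trans (sym (head-lift b (P i))) (trans e (head-lift b' (P j))))
    with refl ← head-injective heads≡ = refl
  twice-odd : ∀ {x y} → x ≢ y → TwiceOdd (dist (doubling P x) (doubling P y))
  twice-odd {b , i} {b' , j} x≢y with head (P i) ≟ head (P j)
  ... | no heads≢ = subst TwiceOdd (sym (dist-lift-≢ b b' (P i) (P j) heads≢))
                      (TwiceOdd-3* (twiceOdd (heads≢ ∘ cong (head ∘ P))))
  ... | yes heads≡ with refl ← head-injective heads≡ =
        subst TwiceOdd (sym (dist-lift-same b b' (P i) (x≢y ∘ cong (_, i)))) (0 , refl)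

configuration : ∀ n → Fin (2 ^ suc n) → Vec ℕ (suc n)
configuration 0       b = 2 * toℕ b ∷ []
configuration (suc n) = doubling (configuration n) ∘ remQuot (2 ^ suc n)

configuration-odd : ∀ n → OddConfiguration (configuration n)
configuration-odd 0 = record { head-injective = injective ; twiceOdd = twice-odd }
  where
  injective : Injective _≡_ _≡_ (head ∘ configuration 0)
  injective {zero}     {zero}     _ = refl
  injective {suc zero} {suc zero} _ = refl
  twice-odd : ∀ {a b} → a ≢ b → TwiceOdd (dist (configuration 0 a) (configuration 0 b))
  twice-odd {zero}     {zero}     a≢b = contradiction refl a≢b
  twice-odd {zero}     {suc zero} _   = 0 , refl
  twice-odd {suc zero} {zero}     _   = 0 , refl
  twice-odd {suc zero} {suc zero} a≢b = contradiction refl a≢b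
configuration-odd (suc n) =
  OddConfiguration-∘ (doubling-odd (configuration-odd n)) (Injection.injective (↔⇒↣ *↔×))

fromℚᵘ-homo-+ : ∀ u v → fromℚᵘ u ℚ.+ fromℚᵘ v ≡ fromℚᵘ (u ℚᵘ.+ v)
fromℚᵘ-homo-+ u v = trans (sym (ℚₚ.fromℚᵘ-toℚᵘ _)) (ℚₚ.fromℚᵘ-cong
  (ℚᵘₚ.≃-trans (ℚₚ.toℚᵘ-homo-+ (fromℚᵘ u) (fromℚᵘ v))
               (ℚᵘₚ.+-cong (ℚₚ.toℚᵘ-fromℚᵘ u) (ℚₚ.toℚᵘ-fromℚᵘ v))))

fromℚᵘ-homo‿- : ∀ u → ℚ.- fromℚᵘ u ≡ fromℚᵘ (ℚᵘ.- u)
fromℚᵘ-homo‿- u = trans (sym (ℚₚ.fromℚᵘ-toℚᵘ _)) (ℚₚ.fromℚᵘ-cong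
  (ℚᵘₚ.≃-trans (ℚₚ.toℚᵘ-homo‿- (fromℚᵘ u)) (ℚᵘₚ.-‿cong (ℚₚ.toℚᵘ-fromℚᵘ u))))

fromℚᵘ-homo-∣-∣ : ∀ u → ℚ.∣ fromℚᵘ u ∣ ≡ fromℚᵘ ℚᵘ.∣ u ∣
fromℚᵘ-homo-∣-∣ u = trans (sym (ℚₚ.fromℚᵘ-toℚᵘ _)) (ℚₚ.fromℚᵘ-cong
  (ℚᵘₚ.≃-trans (ℚₚ.toℚᵘ-homo-∣-∣ (fromℚᵘ u)) (ℚᵘₚ.∣-∣-cong (ℚₚ.toℚᵘ-fromℚᵘ u))))

-- mkℚᵘ i 1 is i / 2 (the denominator is stored as its predecessor), and
-- half i reduces to fromℚᵘ (mkℚᵘ i 1).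
half : ℤ → ℚ
half i = i / 2

half-+ : ∀ i j → half i ℚ.+ half j ≡ half (i ℤ.+ j)
half-+ i j = trans (fromℚᵘ-homo-+ (mkℚᵘ i 1) (mkℚᵘ j 1))
  (ℚₚ.fromℚᵘ-cong {mkℚᵘ i 1 ℚᵘ.+ mkℚᵘ j 1} {mkℚᵘ (i ℤ.+ j) 1} (*≡* (common-denominator i j)))
  where common-denominator : ∀ i j → (i ℤ.* ℤ.+ 2 ℤ.+ j ℤ.* ℤ.+ 2) ℤ.* ℤ.+ 2 ≡ (i ℤ.+ j) ℤ.* ℤ.+ 4
        common-denominator = ℤ-Solver.solve-∀

half-- : ∀ i j → half i ℚ.- half j ≡ half (i ℤ.- j)
half-- i j = trans (cong (half i ℚ.+_) (fromℚᵘ-homo‿- (mkℚᵘ j 1))) (half-+ i (ℤ.- j))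

∣half∣ : ∀ i → ℚ.∣ half i ∣ ≡ half (ℤ.+ ℤ.∣ i ∣)
∣half∣ i = fromℚᵘ-homo-∣-∣ (mkℚᵘ i 1)

half-injective : Injective _≡_ _≡_ half
half-injective {i} {j} e with *≡* i*2≡j*2 ← ℚₚ.fromℚᵘ-injective {mkℚᵘ i 1} {mkℚᵘ j 1} e =
  ℤₚ.*-cancelʳ-≡ i j (ℤ.+ 2) i*2≡j*2

∣m⊖n∣≡∣m-n∣ : ∀ m n → ℤ.∣ m ⊖ n ∣ ≡ ∣ m - n ∣
∣m⊖n∣≡∣m-n∣ m n with ℕₚ.≤-total m n
... | inj₁ m≤n = trans (ℤₚ.∣⊖∣-≤ m≤n) (sym (ℕₚ.m≤n⇒∣m-n∣≡n∸m m≤n))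
... | inj₂ n≤m = trans (ℤₚ.∣m⊖n∣≡∣n⊖m∣ m n) (trans (ℤₚ.∣⊖∣-≤ n≤m) (sym (ℕₚ.m≤n⇒∣n-m∣≡n∸m n≤m)))

∣half-half∣ : ∀ x y → ℚ.∣ half (ℤ.+ x) ℚ.- half (ℤ.+ y) ∣ ≡ half (ℤ.+ ∣ x - y ∣)
∣half-half∣ x y = begin
  ℚ.∣ half (ℤ.+ x) ℚ.- half (ℤ.+ y) ∣  ≡⟨ cong ℚ.∣_∣ (half-- (ℤ.+ x) (ℤ.+ y)) ⟩
  ℚ.∣ half (ℤ.+ x ℤ.- ℤ.+ y) ∣         ≡⟨ ∣half∣ (ℤ.+ x ℤ.- ℤ.+ y) ⟩
  half (ℤ.+ ℤ.∣ ℤ.+ x ℤ.- ℤ.+ y ∣)     ≡⟨ cong (half ∘ ℤ.+_ ∘ ℤ.∣_∣) (ℤₚ.m-n≡m⊖n x y) ⟩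
  half (ℤ.+ ℤ.∣ x ⊖ y ∣)               ≡⟨ cong (half ∘ ℤ.+_) (∣m⊖n∣≡∣m-n∣ x y) ⟩
  half (ℤ.+ ∣ x - y ∣)                 ∎

halfPoint : ∀ {n} → Vec ℕ n → Point n
halfPoint xs i = half (ℤ.+ lookup xs i)

halfPoint-injective : ∀ {n} → Injective _≡_ _≡_ (halfPoint {n})
halfPoint-injective {x = []}     {[]}     _ = refl
halfPoint-injective {x = x ∷ xs} {y ∷ ys} e = cong₂ _∷_
  (ℤₚ.+-injective (half-injective (cong (λ p → p zero) e)))
  (halfPoint-injective (cong (λ p → p ∘ suc) e))

dist₁-halfPoint : ∀ {n} (xs ys : Vec ℕ n) →
                  dist₁ n (halfPoint xs) (halfPoint ys) ≡ half (ℤ.+ dist xs ys)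
dist₁-halfPoint []       []       = sym (ℚₚ.0/n≡0 2)
dist₁-halfPoint {suc n} (x ∷ xs) (y ∷ ys) = begin
  ℚ.∣ half (ℤ.+ x) ℚ.- half (ℤ.+ y) ∣ ℚ.+ dist₁ n (halfPoint xs) (halfPoint ys)
    ≡⟨ cong₂ ℚ._+_ (∣half-half∣ x y) (dist₁-halfPoint xs ys) ⟩
  half (ℤ.+ ∣ x - y ∣) ℚ.+ half (ℤ.+ dist xs ys)
    ≡⟨ half-+ (ℤ.+ ∣ x - y ∣) (ℤ.+ dist xs ys) ⟩
  half (ℤ.+ (∣ x - y ∣ + dist xs ys))
    ∎

TwiceOdd⇒halfOdd : ∀ {d} → TwiceOdd d → IsOddInteger (half (ℤ.+ d))
TwiceOdd⇒halfOdd (k , refl) =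
  ℤ.+ k , ℚₚ.fromℚᵘ-cong {mkℚᵘ (ℤ.+ (2 + 4 * k)) 1} {mkℚᵘ 2k+1 0} (*≡* cross-multiplied)
  where
  2k+1 : ℤ
  2k+1 = ℤ.+ 2 ℤ.* ℤ.+ k ℤ.+ ℤ.+ 1
  halve : ∀ i → (ℤ.+ 2 ℤ.+ ℤ.+ 4 ℤ.* i) ℤ.* ℤ.+ 1 ≡ (ℤ.+ 2 ℤ.* i ℤ.+ ℤ.+ 1) ℤ.* ℤ.+ 2
  halve = ℤ-Solver.solve-∀
  cross-multiplied : ℤ.+ (2 + 4 * k) ℤ.* ℤ.+ 1 ≡ 2k+1 ℤ.* ℤ.+ 2
  cross-multiplied = begin
    ℤ.+ (2 + 4 * k) ℤ.* ℤ.+ 1              ≡⟨ cong (ℤ._* ℤ.+ 1) (ℤₚ.pos-+ 2 (4 * k)) ⟩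
    (ℤ.+ 2 ℤ.+ ℤ.+ (4 * k)) ℤ.* ℤ.+ 1      ≡⟨ cong (λ t → (ℤ.+ 2 ℤ.+ t) ℤ.* ℤ.+ 1) (ℤₚ.pos-* 4 k) ⟩
    (ℤ.+ 2 ℤ.+ ℤ.+ 4 ℤ.* ℤ.+ k) ℤ.* ℤ.+ 1  ≡⟨ halve (ℤ.+ k) ⟩
    2k+1 ℤ.* ℤ.+ 2                         ∎

theorem1p1 : (n : ℕ) → .{{_ : NonZero n}} →
    Σ (Fin (2 ^ n) → Point n) λ P →
      Injective _≡_ _≡_ P
      × ((a : Fin (2 ^ n)) → InHalfIntLattice n (P a))
      × ((a b : Fin (2 ^ n)) → ¬ (a ≡ b) → IsOddInteger (dist₁ n (P a) (P b)))
theorem1p1 (suc n) = P , P-injective , (λ a i → ℤ.+ lookup (configuration n a) i , refl) , P-odd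
  where
  open OddConfiguration (configuration-odd n)
  P : Fin (2 ^ suc n) → Point (suc n)
  P = halfPoint ∘ configuration n
  P-injective : Injective _≡_ _≡_ P
  P-injective {a} {b} =
    head-injective ∘ cong head ∘ halfPoint-injective {x = configuration n a} {configuration n b}
  P-odd : ∀ a b → a ≢ b → IsOddInteger (dist₁ (suc n) (P a) (P b))
  P-odd a b a≢b = subst IsOddInteger (sym (dist₁-halfPoint (configuration n a) (configuration n b)))
                        (TwiceOdd⇒halfOdd (twiceOdd a≢b))
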